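{- Let $(A_n)_{n\ge1}$ and $(B_n)_{n\ge1}$ be the anti-recurrence sequence and its complementary sequence for the linear form $\mathbf a=(1,2)$ (the anti-Pell numbers), so $A_n=B_{2n-1}+2B_{2n}$, and write $B^1_n=B_{2n-1}$, $B^2_n=B_{2n}$. Then for all $n\ge1$: \[0\le A_n-7n+3\le 2,\qquad 0\le 3B^1_n-7n+6\le 3,\qquad 0\le 3B^2_n-7n+2\le 3.\]
   Context: Anti-recurrence sequence: given a vector $\mathbf a=(a_1,\ldots,a_k)$ of positive integers, $k\ge2$, $(A_n)_{n\ge1}$ and $(B_n)_{n\ge1}$ are the unique strictly increasing sequences of positive integers that are complementary (every positive integer lies in exactly one of them) and satisfy $A_n=\sum_{j=1}^k a_jB_{(n-1)k+j}$ for all $n\ge1$. For $\mathbf a=(1,2)$ the sequence begins $A=5,11,20,26,34,\ldots$. -}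

module Defs where

open import Data.Nat using (ℕ; _+_; _*_; _∸_; _≤_; _<_)
open import Data.Product using (Σ; _×_)
open import Data.Sum using (_⊎_)
open import Relation.Binary.PropositionalEquality using (_≡_; _≢_)

-- Sequences are modelled as functions ℕ → ℕ; only indices n ≥ 1 are
-- meaningful (the value at index 0 is unconstrained and irrelevant).

StrictlyIncreasing : (ℕ → ℕ) → Set
StrictlyIncreasing S = ∀ n → 1 ≤ n → S n < S (n + 1)

Positive : (ℕ → ℕ) → Set
Positive S = ∀ n → 1 ≤ n → 1 ≤ S n

Complementary : (ℕ → ℕ) → (ℕ → ℕ) → Set
Complementary A B =
  (∀ m → 1 ≤ m →
     (Σ ℕ λ n → 1 ≤ n × A n ≡ m) ⊎ (Σ ℕ λ n → 1 ≤ n × B n ≡ m))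
  × (∀ n k → 1 ≤ n → 1 ≤ k → A n ≢ B k)

IsAntiRecurrence12 : (ℕ → ℕ) → (ℕ → ℕ) → Set
IsAntiRecurrence12 A B =
  Positive A × Positive B
  × StrictlyIncreasing A × StrictlyIncreasing B
  × Complementary A B
  × (∀ n → 1 ≤ n → A n ≡ 1 * B (2 * n ∸ 1) + 2 * B (2 * n))

-- Since A and B are complementary, B_m = m + c where c is the number of terms of A below B_m,
-- i.e. A_c < B_m < A_{c+1}.  Strong induction on n: if 7i − 3 ≤ A_i ≤ 7i − 1 for all i < n, then
-- for m ≤ 2n the count c is pinned down well enough to give 7m − 5 ≤ 6 B_m ≤ 7m + 2 (the lower
-- bound on A_c comes from B_k ≥ k, which only allows c < n).  At m = 2n − 1 and m = 2n this is
-- exactly the claim for B¹_n and B²_n, and A_n = B¹_n + 2 B²_n then gives 7n − 3 ≤ A_n ≤ 7n − 1.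
module Submission where

open import Defs
open import Data.Nat using (ℕ; _∸_)
open import Data.Product using (Σ; _×_; _,_; proj₁; proj₂)
open import Relation.Binary.PropositionalEquality

module _ where
  open import Data.Nat using (zero; suc; _+_; _*_; _≤_; _<_; _≤?_; _<?_; z≤n; s≤s)
  open import Data.Nat.Properties
  open import Data.Nat.Induction using (<-rec)
  open import Data.Nat.Tactic.RingSolver using (solve)
  open import Data.List using (_∷_; [])
  open import Data.Sum using (inj₁; inj₂)
  open import Relation.Nullary using (yes; no)
  open import Relation.Nullary.Negation using (contradiction)

  infix 4 _∈[_,_]

  _∈[_,_] : ℕ → ℕ → ℕ → Set
  x ∈[ a , b ] = a ≤ x × x ≤ b

  *-cancelˡ-≤-offset : ∀ q {a b r} → r < q → q * a ≤ q * b + r → a ≤ b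
  *-cancelˡ-≤-offset q {a} {b} {r} r<q qa≤qb+r = ≤-pred (*-cancelˡ-< q a (suc b) (begin-strict
      q * a     ≤⟨ qa≤qb+r ⟩
      q * b + r <⟨ +-monoʳ-< (q * b) r<q ⟩
      q * b + q ≡⟨ +-comm (q * b) q ⟩
      q + q * b ≡⟨ *-suc q b ⟨
      q * suc b ∎))
    where open ≤-Reasoning

  module _ {S : ℕ → ℕ} (S-inc : StrictlyIncreasing S) where

    increasing-suc : ∀ {n} → 1 ≤ n → S n < S (suc n)
    increasing-suc {n} 1≤n = subst (λ t → S n < S t) (+-comm n 1) (S-inc n 1≤n)

    increasing-< : ∀ {i j} → 1 ≤ i → i < j → S i < S j
    increasing-< {i} {suc j} 1≤i (s≤s i≤j) with m≤n⇒m<n∨m≡n i≤j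
    ... | inj₁ i<j  = <-trans (increasing-< 1≤i i<j) (increasing-suc (≤-trans 1≤i (<⇒≤ i<j)))
    ... | inj₂ refl = increasing-suc 1≤i

    increasing-≤ : ∀ {i j} → 1 ≤ i → i ≤ j → S i ≤ S j
    increasing-≤ 1≤i i≤j with m≤n⇒m<n∨m≡n i≤j
    ... | inj₁ i<j  = <⇒≤ (increasing-< 1≤i i<j)
    ... | inj₂ refl = ≤-refl

    increasing-cancel-< : ∀ {i j} → 1 ≤ j → S i < S j → i < j
    increasing-cancel-< {i} {j} 1≤j Si<Sj with i <? j
    ... | yes i<j = i<j
    ... | no  i≮j = contradiction (increasing-≤ 1≤j (≮⇒≥ i≮j)) (<⇒≱ Si<Sj)

    increasing-cancel-≤ : ∀ {i j} → 1 ≤ j → S i ≤ S j → i ≤ j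
    increasing-cancel-≤ {i} {j} 1≤j Si≤Sj with i ≤? j
    ... | yes i≤j = i≤j
    ... | no  i≰j = contradiction (increasing-< 1≤j (≰⇒> i≰j)) (≤⇒≯ Si≤Sj)

    index≤term : Positive S → ∀ {n} → 1 ≤ n → n ≤ S n
    index≤term S-pos {suc zero}    1≤n = S-pos 1 1≤n
    index≤term S-pos {suc (suc n)} _   =
      ≤-trans (s≤s (index≤term S-pos (s≤s z≤n))) (increasing-suc (s≤s z≤n))

  -- Exactly c terms of S are ≤ x (when S is increasing); S 0 is not a term, hence the guard.
  Count : (ℕ → ℕ) → ℕ → ℕ → Set
  Count S x c = (1 ≤ c → S c ≤ x) × x < S (suc c)

  count-zero : ∀ {S} → Positive S → Count S 0 0
  count-zero S-pos = (λ ()) , S-pos 1 (s≤s z≤n)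

  count-miss : ∀ {S x c} → (∀ j → 1 ≤ j → S j ≢ suc x) → Count S x c → Count S (suc x) c
  count-miss {c = c} miss (Sc≤x , x<Sc+1) =
    (λ 1≤c → m≤n⇒m≤1+n (Sc≤x 1≤c)) ,
    ≤∧≢⇒< x<Sc+1 (λ eq → miss (suc c) (s≤s z≤n) (sym eq))

  module _ {S : ℕ → ℕ} (S-inc : StrictlyIncreasing S) where

    count-term : ∀ {m} → 1 ≤ m → Count S (S m) m
    count-term 1≤m = (λ _ → ≤-refl) , increasing-suc S-inc 1≤m

    count-≤ : ∀ {x c d} → Count S x c → Count S x d → c ≤ d
    count-≤ {c = c} {d} (Sc≤x , _) (_ , x<Sd+1) with c ≤? d
    ... | yes c≤d = c≤d
    ... | no  c≰d = contradiction (<-≤-trans x<Sd+1 (increasing-≤ S-inc (s≤s z≤n) d<c))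
                                  (≤⇒≯ (Sc≤x (≤-trans (s≤s z≤n) d<c)))
      where d<c = ≰⇒> c≰d

    count-unique : ∀ {x c d} → Count S x c → Count S x d → c ≡ d
    count-unique count-c count-d = ≤-antisym (count-≤ count-c count-d) (count-≤ count-d count-c)

    count-hit : ∀ {x c j} → 1 ≤ j → S j ≡ suc x → Count S x c → Count S (suc x) (suc c)
    count-hit {x} {c} {j} 1≤j Sj≡x+1 (Sc≤x , x<Sc+1) =
      (λ _ → ≤-reflexive Sc+1≡x+1) ,
      subst (_< S (suc (suc c))) Sc+1≡x+1 (increasing-suc S-inc (s≤s z≤n))
      where
      c<j : ∀ {c} → (1 ≤ c → S c ≤ x) → c < j
      c<j {zero}  _    = 1≤j
      c<j {suc _} Sc≤x = increasing-cancel-< S-inc 1≤j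
                           (subst (S (suc _) <_) (sym Sj≡x+1) (s≤s (Sc≤x (s≤s z≤n))))
      j≡c+1 : j ≡ suc c
      j≡c+1 = ≤-antisym (increasing-cancel-≤ S-inc (s≤s z≤n)
                          (subst (_≤ S (suc c)) (sym Sj≡x+1) x<Sc+1)) (c<j Sc≤x)
      Sc+1≡x+1 : S (suc c) ≡ suc x
      Sc+1≡x+1 = trans (cong S (sym j≡c+1)) Sj≡x+1

  module _ {A B : ℕ → ℕ} (A-pos : Positive A) (B-pos : Positive B)
           (A-inc : StrictlyIncreasing A) (B-inc : StrictlyIncreasing B)
           (complementary : Complementary A B) where

    private
      covers = proj₁ complementary
      disjoint = proj₂ complementary

    count-partition : ∀ x → Σ ℕ λ a → Σ ℕ λ b → a + b ≡ x × Count A x a × Count B x b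
    count-partition zero = 0 , 0 , refl , count-zero A-pos , count-zero B-pos
    count-partition (suc x) with count-partition x | covers (suc x) (s≤s z≤n)
    ... | a , b , a+b≡x , count-A , count-B | inj₁ (j , 1≤j , Aj≡x+1) =
      suc a , b , cong suc a+b≡x , count-hit A-inc 1≤j Aj≡x+1 count-A ,
      count-miss (λ k 1≤k Bk≡x+1 → disjoint j k 1≤j 1≤k (trans Aj≡x+1 (sym Bk≡x+1))) count-B
    ... | a , b , a+b≡x , count-A , count-B | inj₂ (j , 1≤j , Bj≡x+1) =
      a , suc b , trans (+-suc a b) (cong suc a+b≡x) ,
      count-miss (λ k 1≤k Ak≡x+1 → disjoint k j 1≤k 1≤j (trans Ak≡x+1 (sym Bj≡x+1))) count-A ,
      count-hit B-inc 1≤j Bj≡x+1 count-B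

    complement-term : ∀ {m} → 1 ≤ m →
      Σ ℕ λ c → B m ≡ m + c × (1 ≤ c → A c < m + c) × m + c < A (suc c)
    complement-term {m} 1≤m with count-partition (B m)
    ... | c , b , c+b≡Bm , (Ac≤Bm , Bm<Ac+1) , count-B =
      c , Bm≡m+c ,
      (λ 1≤c → subst (A c <_) Bm≡m+c (≤∧≢⇒< (Ac≤Bm 1≤c) (disjoint c m 1≤c 1≤m))) ,
      subst (_< A (suc c)) Bm≡m+c Bm<Ac+1
      where
      Bm≡m+c : B m ≡ m + c
      Bm≡m+c = begin
        B m   ≡⟨ c+b≡Bm ⟨
        c + b ≡⟨ cong (c +_) (count-unique B-inc count-B (count-term B-inc 1≤m)) ⟩
        c + m ≡⟨ +-comm c m ⟩
        m + c ∎
        where open ≡-Reasoning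

  odd-term-bound : ∀ k b → 6 * b + 5 ∈[ 7 * suc (2 * k) , 7 * suc (2 * k) + 7 ] →
                   3 * b + 6 ∈[ 7 * suc k , 7 * suc k + 3 ]
  odd-term-bound k b (lower , upper) =
    *-cancelˡ-≤ 2 (begin
      2 * (7 * suc k)         ≡⟨ solve (k ∷ []) ⟩
      7 * suc (2 * k) + 7     ≤⟨ +-monoˡ-≤ 7 lower ⟩
      6 * b + 5 + 7           ≡⟨ solve (b ∷ []) ⟩
      2 * (3 * b + 6)         ∎) ,
    *-cancelˡ-≤-offset 2 (s≤s (s≤s z≤n)) (begin
      2 * (3 * b + 6)         ≡⟨ solve (b ∷ []) ⟩
      6 * b + 5 + 7           ≤⟨ +-monoˡ-≤ 7 upper ⟩
      7 * suc (2 * k) + 7 + 7 ≡⟨ solve (k ∷ []) ⟩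
      2 * (7 * suc k + 3) + 1 ∎)
    where open ≤-Reasoning

  even-term-bound : ∀ k b → 6 * b + 5 ∈[ 7 * (2 * suc k) , 7 * (2 * suc k) + 7 ] →
                    3 * b + 2 ∈[ 7 * suc k , 7 * suc k + 3 ]
  even-term-bound k b (lower , upper) =
    *-cancelˡ-≤-offset 2 (s≤s (s≤s z≤n)) (begin
      2 * (7 * suc k)         ≡⟨ solve (k ∷ []) ⟩
      7 * (2 * suc k)         ≤⟨ lower ⟩
      6 * b + 5               ≡⟨ solve (b ∷ []) ⟩
      2 * (3 * b + 2) + 1     ∎) ,
    *-cancelˡ-≤-offset 2 (s≤s (s≤s z≤n)) (begin
      2 * (3 * b + 2)         ≤⟨ m≤m+n _ 1 ⟩
      2 * (3 * b + 2) + 1     ≡⟨ solve (b ∷ []) ⟩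
      6 * b + 5               ≤⟨ upper ⟩
      7 * (2 * suc k) + 7     ≡⟨ solve (k ∷ []) ⟩
      2 * (7 * suc k + 3) + 1 ∎)
    where open ≤-Reasoning

  combined-bound : ∀ n b₁ b₂ → 3 * b₁ + 6 ∈[ 7 * n , 7 * n + 3 ] →
                   3 * b₂ + 2 ∈[ 7 * n , 7 * n + 3 ] →
                   b₁ + 2 * b₂ + 3 ∈[ 7 * n , 7 * n + 2 ]
  combined-bound n b₁ b₂ (lower₁ , upper₁) (lower₂ , upper₂) =
    *-cancelˡ-≤-offset 3 (s≤s (s≤s z≤n)) (begin
      3 * (7 * n)                   ≡⟨ solve (n ∷ []) ⟩
      7 * n + 2 * (7 * n)           ≤⟨ +-mono-≤ lower₁ (*-monoʳ-≤ 2 lower₂) ⟩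
      3 * b₁ + 6 + 2 * (3 * b₂ + 2) ≡⟨ solve (b₁ ∷ b₂ ∷ []) ⟩
      3 * (b₁ + 2 * b₂ + 3) + 1     ∎) ,
    *-cancelˡ-≤-offset 3 (s≤s (s≤s (s≤s z≤n))) (+-cancelʳ-≤ 1 _ _ (begin
      3 * (b₁ + 2 * b₂ + 3) + 1     ≡⟨ solve (b₁ ∷ b₂ ∷ []) ⟩
      3 * b₁ + 6 + 2 * (3 * b₂ + 2) ≤⟨ +-mono-≤ upper₁ (*-monoʳ-≤ 2 upper₂) ⟩
      7 * n + 3 + 2 * (7 * n + 3)   ≡⟨ solve (n ∷ []) ⟩
      3 * (7 * n + 2) + 2 + 1       ∎))
    where open ≤-Reasoning

  odd-index : ∀ k → 2 * suc k ∸ 1 ≡ suc (2 * k)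
  odd-index k = cong (_∸ 1) (*-suc 2 k)

  module AntiPell {A B : ℕ → ℕ} (H : IsAntiRecurrence12 A B) where

    private
      A-pos    = proj₁ H
      B-pos    = proj₁ (proj₂ H)
      A-inc    = proj₁ (proj₂ (proj₂ H))
      B-inc    = proj₁ (proj₂ (proj₂ (proj₂ H)))
      comp     = proj₁ (proj₂ (proj₂ (proj₂ (proj₂ H))))
      A≡B+2B   = proj₂ (proj₂ (proj₂ (proj₂ (proj₂ H))))

    recurrence : ∀ k → A (suc k) ≡ B (suc (2 * k)) + 2 * B (2 * suc k)
    recurrence k = trans (A≡B+2B (suc k) (s≤s z≤n))
      (cong (_+ 2 * B (2 * suc k)) (trans (*-identityˡ _) (cong B (odd-index k))))

    A-lower : ∀ k → 6 * suc k ≤ A (suc k) + 1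
    A-lower k = begin
      6 * suc k                               ≡⟨ solve (k ∷ []) ⟩
      suc (2 * k) + 2 * (2 * suc k) + 1       ≤⟨ +-monoˡ-≤ 1 (+-mono-≤ (index≤B _) (*-monoʳ-≤ 2 (index≤B _))) ⟩
      B (suc (2 * k)) + 2 * B (2 * suc k) + 1 ≡⟨ cong (_+ 1) (recurrence k) ⟨
      A (suc k) + 1                           ∎
      where
      open ≤-Reasoning
      index≤B : ∀ i → suc i ≤ B (suc i)
      index≤B i = index≤term B-inc B-pos (s≤s z≤n)

    ABound : ℕ → Set
    ABound n = A n + 3 ∈[ 7 * n , 7 * n + 2 ]

    ABoundsBelow : ℕ → Set
    ABoundsBelow n = ∀ i → 1 ≤ i → i < n → ABound i

    -- c counts the terms of A below B_m = m + c.
    few-below : ∀ {k m c} → ABoundsBelow (suc k) → m ≤ 2 * suc k →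
                (1 ≤ c → A c < m + c) → 6 * c ≤ m + 2
    few-below {c = zero} _ _ _ = z≤n
    few-below {k} {m} {c@(suc c′)} ih m≤2n Ac<m+c = +-cancelˡ-≤ c _ _ (begin
        c + 6 * c     ≡⟨ solve (c′ ∷ []) ⟩
        7 * c         ≤⟨ proj₁ (ih c (s≤s z≤n) c<n) ⟩
        A c + 3       ≡⟨ +-assoc (A c) 1 2 ⟨
        A c + 1 + 2   ≤⟨ +-monoˡ-≤ 2 Ac+1≤m+c ⟩
        m + c + 2     ≡⟨ solve (m ∷ c′ ∷ []) ⟩
        c + (m + 2)   ∎)
      where
      open ≤-Reasoning
      Ac+1≤m+c : A c + 1 ≤ m + c
      Ac+1≤m+c = subst (_≤ m + c) (+-comm 1 (A c)) (Ac<m+c (s≤s z≤n))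
      5c≤2n : 5 * c ≤ 2 * suc k
      5c≤2n = +-cancelʳ-≤ c _ _ (begin
        5 * c + c     ≡⟨ solve (c′ ∷ []) ⟩
        6 * c         ≤⟨ A-lower c′ ⟩
        A c + 1       ≤⟨ Ac+1≤m+c ⟩
        m + c         ≤⟨ +-monoˡ-≤ c m≤2n ⟩
        2 * suc k + c ∎)
      c<n : c < suc k
      c<n = *-cancelˡ-< 5 c (suc k)
              (≤-<-trans 5c≤2n (*-monoˡ-< (suc k) {2} {5} (s≤s (s≤s (s≤s z≤n)))))

    many-below : ∀ {k m c} → ABoundsBelow (suc k) → m ≤ 2 * suc k →
                 m + c < A (suc c) → m ≤ 6 * c + 5
    many-below {k} {m} {c} ih m≤2n m+c<Ac+1 with suc c <? suc k
    ... | yes c+1<n = +-cancelˡ-≤ (c + 4) _ _ (begin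
        c + 4 + m           ≡⟨ solve (m ∷ c ∷ []) ⟩
        suc (m + c) + 3     ≤⟨ +-monoˡ-≤ 3 m+c<Ac+1 ⟩
        A (suc c) + 3       ≤⟨ proj₂ (ih (suc c) (s≤s z≤n) c+1<n) ⟩
        7 * suc c + 2       ≡⟨ solve (c ∷ []) ⟩
        c + 4 + (6 * c + 5) ∎)
      where open ≤-Reasoning
    ... | no  c+1≮n = begin
        m                         ≤⟨ m≤2n ⟩
        2 * suc k                 ≤⟨ *-monoʳ-≤ 2 (≮⇒≥ c+1≮n) ⟩
        2 * suc c                 ≤⟨ m≤m+n _ _ ⟩
        2 * suc c + (4 * c + 3)   ≡⟨ solve (c ∷ []) ⟩
        6 * c + 5                 ∎
      where open ≤-Reasoning

    B-window : ∀ {k m} → ABoundsBelow (suc k) → 1 ≤ m → m ≤ 2 * suc k →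
               6 * B m + 5 ∈[ 7 * m , 7 * m + 7 ]
    B-window {k} {m} ih 1≤m m≤2n with complement-term A-pos B-pos A-inc B-inc comp 1≤m
    ... | c , Bm≡m+c , Ac<m+c , m+c<Ac+1 rewrite Bm≡m+c = lower , upper
      where
      open ≤-Reasoning
      lower : 7 * m ≤ 6 * (m + c) + 5
      lower = begin
        7 * m               ≡⟨ solve (m ∷ []) ⟩
        6 * m + m           ≤⟨ +-monoʳ-≤ (6 * m) (many-below ih m≤2n m+c<Ac+1) ⟩
        6 * m + (6 * c + 5) ≡⟨ solve (m ∷ c ∷ []) ⟩
        6 * (m + c) + 5     ∎
      upper : 6 * (m + c) + 5 ≤ 7 * m + 7
      upper = begin
        6 * (m + c) + 5     ≡⟨ solve (m ∷ c ∷ []) ⟩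
        6 * m + 6 * c + 5   ≤⟨ +-monoˡ-≤ 5 (+-monoʳ-≤ (6 * m) (few-below ih m≤2n Ac<m+c)) ⟩
        6 * m + (m + 2) + 5 ≡⟨ solve (m ∷ []) ⟩
        7 * m + 7           ∎

    bounds-step : ∀ k → ABoundsBelow (suc k) →
             ABound (suc k)
             × 3 * B (2 * suc k ∸ 1) + 6 ∈[ 7 * suc k , 7 * suc k + 3 ]
             × 3 * B (2 * suc k) + 2 ∈[ 7 * suc k , 7 * suc k + 3 ]
    bounds-step k ih =
      subst (λ a → a + 3 ∈[ 7 * suc k , 7 * suc k + 2 ]) (sym (recurrence k))
            (combined-bound (suc k) (B (suc (2 * k))) (B (2 * suc k)) odd even) ,
      subst (λ i → 3 * B i + 6 ∈[ 7 * suc k , 7 * suc k + 3 ]) (sym (odd-index k)) odd ,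
      even
      where
      odd : 3 * B (suc (2 * k)) + 6 ∈[ 7 * suc k , 7 * suc k + 3 ]
      odd = odd-term-bound k (B (suc (2 * k)))
              (B-window ih (s≤s z≤n) (≤-trans (n≤1+n _) (≤-reflexive (sym (*-suc 2 k)))))
      even : 3 * B (2 * suc k) + 2 ∈[ 7 * suc k , 7 * suc k + 3 ]
      even = even-term-bound k (B (2 * suc k)) (B-window ih (s≤s z≤n) ≤-refl)

    A-bound : ∀ n → 1 ≤ n → ABound n
    A-bound = <-rec (λ n → 1 ≤ n → ABound n) step
      where
      step : ∀ n → (∀ {i} → i < n → 1 ≤ i → ABound i) → 1 ≤ n → ABound n
      step (suc k) ih _ = proj₁ (bounds-step k (λ i 1≤i i<n → ih i<n 1≤i))

open import Data.Integer using (ℤ; +_; _+_; _-_; _*_; _≤_; +≤+)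
open import Data.Integer.Properties using (pos-+; pos-*; [+m]-[+n]≡m⊖n; ⊖-≥)
open import Data.Nat using (suc; z≤n)
open import Data.Nat.Properties using (m≤n+o⇒m∸n≤o)
open import Data.Integer.Tactic.RingSolver using (solve-∀)

∈[]⇒ℤ-bounds : ∀ {x lo r} → x ∈[ lo , lo Data.Nat.+ r ] →
               (+ 0 ≤ + x - + lo) × (+ x - + lo ≤ + r)
∈[]⇒ℤ-bounds {x} {lo} (lo≤x , x≤lo+r) rewrite [+m]-[+n]≡m⊖n x lo | ⊖-≥ lo≤x =
  +≤+ z≤n , +≤+ (m≤n+o⇒m∸n≤o x lo x≤lo+r)

affine≡ : ∀ a n c → + a - + 7 * + n + + c ≡ + (a Data.Nat.+ c) - + (7 Data.Nat.* n)
affine≡ a n c rewrite pos-+ a c | pos-* 7 n = sub-add-comm (+ a) (+ 7 * + n) (+ c)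
  where
  sub-add-comm : ∀ (x y z : ℤ) → x - y + z ≡ x + z - y
  sub-add-comm = solve-∀

affine-bounds : ∀ a n {c r} → a Data.Nat.+ c ∈[ 7 Data.Nat.* n , 7 Data.Nat.* n Data.Nat.+ r ] →
                (+ 0 ≤ + a - + 7 * + n + + c) × (+ a - + 7 * + n + + c ≤ + r)
affine-bounds a n {c} window rewrite affine≡ a n c = ∈[]⇒ℤ-bounds window

scaled-affine-bounds : ∀ b n {c r} →
  3 Data.Nat.* b Data.Nat.+ c ∈[ 7 Data.Nat.* n , 7 Data.Nat.* n Data.Nat.+ r ] →
  (+ 0 ≤ + 3 * + b - + 7 * + n + + c) × (+ 3 * + b - + 7 * + n + + c ≤ + r)
scaled-affine-bounds b n window rewrite sym (pos-* 3 b) = affine-bounds (3 Data.Nat.* b) n window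

theorem5 : (A B : ℕ → ℕ) → IsAntiRecurrence12 A B →
    ∀ (n : ℕ) → 1 Data.Nat.≤ n →
      ((+ 0 ≤ (+ A n - + 7 * + n + + 3)) × ((+ A n - + 7 * + n + + 3) ≤ + 2))
      × ((+ 0 ≤ (+ 3 * + B (2 Data.Nat.* n ∸ 1) - + 7 * + n + + 6))
         × ((+ 3 * + B (2 Data.Nat.* n ∸ 1) - + 7 * + n + + 6) ≤ + 3))
      × ((+ 0 ≤ (+ 3 * + B (2 Data.Nat.* n) - + 7 * + n + + 2))
         × ((+ 3 * + B (2 Data.Nat.* n) - + 7 * + n + + 2) ≤ + 3))
theorem5 A B H (suc k) _ =
  let A-window , B¹-window , B²-window = bounds-step k (λ i 1≤i _ → A-bound i 1≤i)
  in affine-bounds (A (suc k)) (suc k) A-window ,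
     scaled-affine-bounds (B (2 Data.Nat.* suc k ∸ 1)) (suc k) B¹-window ,
     scaled-affine-bounds (B (2 Data.Nat.* suc k)) (suc k) B²-window
  where open AntiPell H
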